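{- Let $M=(E,G)$ be a matroid, $G_0$ a hyperplane of $G$, $M_0=(E\cap G_0,G_0)$, and suppose $M$ is a semidoubling of $M_0$ with respect to a hyperplane $H_0$ of $G_0$. Then $\chi(M)=\chi(M|H_0)+1$.
   Context: A simple binary matroid (here just "matroid") is a pair $M=(E,G)$, where $G$ is identified with $\mathbb F_2^n\setminus\{0\}$ and $E\subseteq G$. A flat of $G$ is a set $V\setminus\{0\}$ with $V$ a subspace, of dimension $\dim V$; a hyperplane is a flat of dimension $n-1$; $M|F=(E\cap F,F)$. The critical number $\chi(M)$ of an $n$-dimensional matroid is the smallest $k\ge0$ such that $G\setminus E$ contains a flat of dimension $n-k$. "$M$ is a semidoubling of $M_0=M|G_0$ with respect to $H_0$" means there is $w\in G\setminus(G_0\cup E)$ with $E=(E\cap G_0)\cup\{w+x:x\in(E\cap G_0)\triangle(G_0\setminus H_0)\}$. -}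

module Defs where

open import Data.Bool using (Bool; true; false; _xor_; not)
open import Data.Nat using (ℕ; zero; suc; _∸_; _<_; _≤_)
open import Data.Vec using (Vec; []; _∷_; replicate; zipWith; foldr; lookup)
open import Data.Fin using (Fin)
open import Data.Product using (Σ; ∃; ∃-syntax; _×_; _,_)
open import Data.Sum using (_⊎_)
open import Relation.Binary.PropositionalEquality using (_≡_; _≢_)
open import Relation.Nullary using (¬_)

-- The ambient group F₂ⁿ; G is F₂ⁿ ∖ {0}.
V : ℕ → Set
V n = Vec Bool n

0v : ∀ {n} → V n
0v = replicate _ false

infixl 6 _⊕_
_⊕_ : ∀ {n} → V n → V n → V n
_⊕_ = zipWith _xor_

_·_ : ∀ {n} → Bool → V n → V n
true  · v = v
false · v = 0v

lincomb : ∀ {n k} → Vec Bool k → Vec (V n) k → V n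
lincomb []       []       = 0v
lincomb (c ∷ cs) (b ∷ bs) = (c · b) ⊕ lincomb cs bs

Independent : ∀ {n k} → Vec (V n) k → Set
Independent {k = k} bs = ∀ (c : Vec Bool k) → lincomb c bs ≡ 0v → c ≡ replicate k false

-- A flat of dimension k is V∖{0} for a subspace V of dimension k, i.e. the
-- span of k linearly independent vectors, minus 0.  We present a flat by
-- such a basis; membership in the flat:
_∈F_ : ∀ {n k} → V n → Vec (V n) k → Set
_∈F_ {k = k} x bs = x ≢ 0v × ∃[ c ] (lincomb {k = k} c bs ≡ x)

infix 4 _⊆F_
_⊆F_ : ∀ {n k l} → Vec (V n) k → Vec (V n) l → Set
bs ⊆F cs = ∀ x → x ∈F bs → x ∈F cs

-- A (simple binary) matroid: E ⊆ G = F₂ⁿ∖{0}, given by a Boolean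
-- characteristic function vanishing at 0.
record Matroid (n : ℕ) : Set where
  field
    E    : V n → Bool
    E-0  : E 0v ≡ false

open Matroid public

infix 4 _∈E_ _∈F_
_∈E_ : ∀ {n} → V n → Matroid n → Set
x ∈E M = E M x ≡ true

-- For a flat F (given by a basis of d independent vectors) the restriction
-- M|F = (E ∩ F, F) is a d-dimensional matroid.  Its critical number is the
-- smallest k ≥ 0 such that F ∖ E contains a flat of dimension d − k
-- (flats of F being the flats of G contained in F).
AvoidingFlat : ∀ {n d} → Matroid n → Vec (V n) d → ℕ → Set
AvoidingFlat {n} M F j =
  Σ (Vec (V n) j) λ W → Independent W × W ⊆F F × (∀ x → x ∈F W → ¬ (x ∈E M))

IsCriticalNumberOn : ∀ {n d} → Matroid n → Vec (V n) d → ℕ → Set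
IsCriticalNumberOn {d = d} M F k =
  k ≤ d × AvoidingFlat M F (d ∸ k) × (∀ k′ → k′ < k → ¬ AvoidingFlat M F (d ∸ k′))

IsCriticalNumber : ∀ {n} → Matroid n → ℕ → Set
IsCriticalNumber {n} M k =
  k ≤ n × (Σ (Vec (V n) (n ∸ k)) λ W → Independent W × (∀ x → x ∈F W → ¬ (x ∈E M)))
        × (∀ k′ → k′ < k →
             ¬ (Σ (Vec (V n) (n ∸ k′)) λ W → Independent W × (∀ x → x ∈F W → ¬ (x ∈E M))))

infix 2 _⇔′_
infixr 3 _△_
_⇔′_ : Set → Set → Set
A ⇔′ B = (A → B) × (B → A)

_△_ : Set → Set → Set
A △ B = (A × ¬ B) ⊎ (B × ¬ A)

IsSemidoubling : ∀ {n a b} → Matroid n → (G₀ : Vec (V n) a) → (H₀ : Vec (V n) b) → Set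
IsSemidoubling {n} M G₀ H₀ =
  Σ (V n) λ w →
    w ≢ 0v × ¬ (w ∈F G₀) × ¬ (w ∈E M) ×
    (∀ y → y ∈E M ⇔′
       ((y ∈E M × y ∈F G₀) ⊎
        (∃[ x ] (((x ∈E M × x ∈F G₀) △ (x ∈F G₀ × ¬ (x ∈F H₀))) × y ≡ w ⊕ x))))

-- Write w for the semidoubling vector.  On H₀, adding w preserves membership
-- in E, while it sends the points of G₀ ∖ H₀ outside E into E.  Hence a flat
-- F ⊆ H₀ avoiding E extends to the flat spanned by w and F, one dimension up,
-- which still avoids E.  Conversely, if a flat U avoids E, so does the flat of
-- points of H₀ lying in the span of w and U, and it has codimension at most one
-- in U: if w ∈ U, then U ∩ G₀ (a hyperplane section of U) already lies in H₀,
-- since a point x ∈ U ∩ (G₀ ∖ H₀) would put w + x into U ∩ E; if w ∉ U, the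
-- span of w and U has one dimension more and H₀ cuts it out by two linear
-- conditions.  All dimension counts reduce to one fact, proved by repeated
-- hyperplane sections: a span of k vectors contains no k + 1 independent ones.
module Submission where

open import Algebra.Bundles using (CommutativeSemigroup)
import Algebra.Properties.CommutativeSemigroup as CommutativeSemigroupProperties
open import Data.Bool using (Bool; true; false; _xor_; _∧_)
open import Data.Bool.Properties
  using (xor-assoc; xor-comm; xor-identityˡ; xor-identityʳ; xor-same; ∧-identityʳ)
  renaming (_≟_ to _≟ᵇ_)
open import Data.Empty using (⊥-elim)
open import Data.Fin.Subset.Properties using (anySubset?)
open import Data.Nat using (ℕ; zero; suc; _≤_; _<_; _∸_; z≤n; s≤s)
open import Data.Nat.Properties using (1+n≰n; m≤n⇒m≤1+n; +-∸-assoc; <⇒≤; ≤-trans)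
open import Data.Product using (Σ; ∃-syntax; _×_; _,_; proj₁; proj₂)
open import Data.Sum using (_⊎_; inj₁; inj₂)
open import Data.Vec using (Vec; []; _∷_; head; tail; map)
open import Data.Vec.Properties
  using (zipWith-assoc; zipWith-comm; zipWith-identityˡ; zipWith-identityʳ; ≡-dec)
open import Data.Vec.Relation.Unary.All as All using (All; []; _∷_)
open import Data.Vec.Relation.Unary.All.Properties using (map⁺)
open import Function using (_∘_)
open import Relation.Binary.PropositionalEquality
  using (_≡_; _≢_; refl; sym; trans; cong; cong₂; subst; module ≡-Reasoning)
open import Relation.Binary.PropositionalEquality.Algebra using (isMagma)
open import Relation.Nullary using (¬_; Dec; yes; no)
open import Relation.Nullary.Decidable using (¬?; decidable-stable)
open import Relation.Unary using (Decidable; _∩_; _⊆_)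

open import Defs

open ≡-Reasoning

⊕-assoc : ∀ {n} (x y z : V n) → (x ⊕ y) ⊕ z ≡ x ⊕ (y ⊕ z)
⊕-assoc = zipWith-assoc xor-assoc

⊕-comm : ∀ {n} (x y : V n) → x ⊕ y ≡ y ⊕ x
⊕-comm = zipWith-comm xor-comm

⊕-identityˡ : ∀ {n} (x : V n) → 0v ⊕ x ≡ x
⊕-identityˡ = zipWith-identityˡ xor-identityˡ

⊕-identityʳ : ∀ {n} (x : V n) → x ⊕ 0v ≡ x
⊕-identityʳ = zipWith-identityʳ xor-identityʳ

⊕-self : ∀ {n} (x : V n) → x ⊕ x ≡ 0v
⊕-self []      = refl
⊕-self (a ∷ x) = cong₂ _∷_ (xor-same a) (⊕-self x)

⊕-interchange : ∀ {n} (a b c d : V n) → (a ⊕ b) ⊕ (c ⊕ d) ≡ (a ⊕ c) ⊕ (b ⊕ d)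
⊕-interchange {n} = interchange
  where
    ⊕-commutativeSemigroup : CommutativeSemigroup _ _
    ⊕-commutativeSemigroup = record
      { isCommutativeSemigroup = record
        { isSemigroup = record { isMagma = isMagma _⊕_ ; assoc = ⊕-assoc {n} }
        ; comm        = ⊕-comm
        }
      }
    open CommutativeSemigroupProperties ⊕-commutativeSemigroup using (interchange)

⊕-cancelˡ : ∀ {n} (x y : V n) → x ⊕ (x ⊕ y) ≡ y
⊕-cancelˡ x y = begin
  x ⊕ (x ⊕ y)  ≡⟨ sym (⊕-assoc x x y) ⟩
  (x ⊕ x) ⊕ y  ≡⟨ cong (_⊕ y) (⊕-self x) ⟩
  0v ⊕ y       ≡⟨ ⊕-identityˡ y ⟩
  y            ∎

⊕-cancelʳ : ∀ {n} (x y : V n) → (x ⊕ y) ⊕ y ≡ x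
⊕-cancelʳ x y = begin
  (x ⊕ y) ⊕ y  ≡⟨ ⊕-assoc x y y ⟩
  x ⊕ (y ⊕ y)  ≡⟨ cong (x ⊕_) (⊕-self y) ⟩
  x ⊕ 0v       ≡⟨ ⊕-identityʳ x ⟩
  x            ∎

⊕-injectiveˡ : ∀ {n} (x : V n) {y z} → x ⊕ y ≡ x ⊕ z → y ≡ z
⊕-injectiveˡ x {y} {z} e = begin
  y            ≡⟨ sym (⊕-cancelˡ x y) ⟩
  x ⊕ (x ⊕ y)  ≡⟨ cong (x ⊕_) e ⟩
  x ⊕ (x ⊕ z)  ≡⟨ ⊕-cancelˡ x z ⟩
  z            ∎

⊕≡0⇒≡ : ∀ {n} {x y : V n} → x ⊕ y ≡ 0v → x ≡ y
⊕≡0⇒≡ {x = x} e = sym (⊕-injectiveˡ x (trans e (sym (⊕-self x))))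

xor-· : ∀ {n} a b (x : V n) → (a xor b) · x ≡ (a · x) ⊕ (b · x)
xor-· true  true  x = sym (⊕-self x)
xor-· true  false x = sym (⊕-identityʳ x)
xor-· false true  x = sym (⊕-identityˡ x)
xor-· false false x = sym (⊕-identityˡ 0v)

V₀-trivial : (x : V 0) → x ≡ 0v
V₀-trivial [] = refl

head-tail-0 : ∀ {n} {x : V (suc n)} → head x ≡ false → tail x ≡ 0v → x ≡ 0v
head-tail-0 {x = a ∷ x} = cong₂ _∷_

Additive : ∀ {m n} → (V m → V n) → Set
Additive f = ∀ x y → f (x ⊕ y) ≡ f x ⊕ f y

module _ {m n} {f : V m → V n} (additive : Additive f) where

  additive-0 : f 0v ≡ 0v
  additive-0 = begin
    f 0v         ≡⟨ cong f (sym (⊕-self 0v)) ⟩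
    f (0v ⊕ 0v)  ≡⟨ additive 0v 0v ⟩
    f 0v ⊕ f 0v  ≡⟨ ⊕-self (f 0v) ⟩
    0v           ∎

  additive-· : ∀ b x → f (b · x) ≡ b · f x
  additive-· true  x = refl
  additive-· false x = additive-0

  lincomb-map : ∀ {k} (c : Vec Bool k) (A : Vec (V m) k) → lincomb c (map f A) ≡ f (lincomb c A)
  lincomb-map []      []      = sym additive-0
  lincomb-map (b ∷ c) (a ∷ A) = begin
    (b · f a) ⊕ lincomb c (map f A)  ≡⟨ cong₂ _⊕_ (sym (additive-· b a)) (lincomb-map c A) ⟩
    f (b · a) ⊕ f (lincomb c A)      ≡⟨ sym (additive _ _) ⟩
    f ((b · a) ⊕ lincomb c A)        ∎

tail-additive : ∀ {n} → Additive (tail {n = n})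
tail-additive (a ∷ x) (b ∷ y) = refl

lincomb-additive : ∀ {n k} (B : Vec (V n) k) → Additive (λ c → lincomb c B)
lincomb-additive []      []      []      = sym (⊕-identityˡ 0v)
lincomb-additive (b ∷ B) (s ∷ c) (t ∷ d) = begin
  ((s xor t) · b) ⊕ lincomb (c ⊕ d) B
    ≡⟨ cong₂ _⊕_ (xor-· s t b) (lincomb-additive B c d) ⟩
  ((s · b) ⊕ (t · b)) ⊕ (lincomb c B ⊕ lincomb d B)
    ≡⟨ ⊕-interchange _ _ _ _ ⟩
  ((s · b) ⊕ lincomb c B) ⊕ ((t · b) ⊕ lincomb d B)
    ∎

lincomb-zeroˡ : ∀ {n k} (B : Vec (V n) k) → lincomb 0v B ≡ 0v
lincomb-zeroˡ B = additive-0 (lincomb-additive B)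

lincomb-head : ∀ {n k} (a : V n) (A : Vec (V n) k) → lincomb (true ∷ 0v) (a ∷ A) ≡ a
lincomb-head a A = trans (cong (a ⊕_) (lincomb-zeroˡ A)) (⊕-identityʳ a)

Linear : ∀ {n} → (V n → Bool) → Set
Linear φ = ∀ x y → φ (x ⊕ y) ≡ φ x xor φ y

Ker : ∀ {n} → (V n → Bool) → V n → Set
Ker φ x = φ x ≡ false

module _ {n} {φ : V n → Bool} (linear : Linear φ) where

  linear-0 : φ 0v ≡ false
  linear-0 = trans (cong φ (sym (⊕-self 0v))) (trans (linear 0v 0v) (xor-same (φ 0v)))

  linear-· : ∀ b x → φ (b · x) ≡ b ∧ φ x
  linear-· true  x = refl
  linear-· false x = linear-0

  linear-∘ : ∀ {m} {f : V m → V n} → Additive f → Linear (φ ∘ f)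
  linear-∘ {f = f} additive x y = trans (cong φ (additive x y)) (linear (f x) (f y))

head-linear : ∀ {n} → Linear (head {n = n})
head-linear (a ∷ x) (b ∷ y) = refl

InSpan : ∀ {n k} → Vec (V n) k → V n → Set
InSpan B x = ∃[ c ] (lincomb c B ≡ x)

record Subspace {n} (P : V n → Set) : Set where
  field
    0∈       : P 0v
    ⊕-closed : ∀ {x y} → P x → P y → P (x ⊕ y)

  ·-closed : ∀ b {x} → P x → P (b · x)
  ·-closed true  px = px
  ·-closed false _  = 0∈

  lincomb-closed : ∀ {k} {A : Vec (V n) k} → All P A → ∀ c → P (lincomb c A)
  lincomb-closed []        []      = 0∈
  lincomb-closed (pa ∷ pA) (b ∷ c) = ⊕-closed (·-closed b pa) (lincomb-closed pA c)

  span⊆ : ∀ {k} {A : Vec (V n) k} → All P A → InSpan A ⊆ P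
  span⊆ pA (c , refl) = lincomb-closed pA c

open Subspace using (0∈; ⊕-closed; ·-closed; lincomb-closed; span⊆)

InSpan-subspace : ∀ {n k} (B : Vec (V n) k) → Subspace (InSpan B)
InSpan-subspace B = record
  { 0∈       = 0v , lincomb-zeroˡ B
  ; ⊕-closed = λ { (c , refl) (d , refl) → c ⊕ d , lincomb-additive B c d }
  }

Ker-subspace : ∀ {n} {φ : V n → Bool} → Linear φ → Subspace (Ker φ)
Ker-subspace {φ = φ} linear = record
  { 0∈       = linear-0 {φ = φ} linear
  ; ⊕-closed = λ {x} {y} φx φy → trans (linear x y) (cong₂ _xor_ φx φy)
  }

∩-subspace : ∀ {n} {P Q : V n → Set} → Subspace P → Subspace Q → Subspace (P ∩ Q)
∩-subspace P Q = record
  { 0∈       = 0∈ P , 0∈ Q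
  ; ⊕-closed = λ (px , qx) (py , qy) → ⊕-closed P px py , ⊕-closed Q qx qy
  }

InSpan-∷ : ∀ {n k} {u : V n} {B : Vec (V n) k} → InSpan B ⊆ InSpan (u ∷ B)
InSpan-∷ (c , refl) = false ∷ c , ⊕-identityˡ _

members-inSpan : ∀ {n k} (A : Vec (V n) k) → All (InSpan A) A
members-inSpan []      = []
members-inSpan (a ∷ A) = (true ∷ 0v , lincomb-head a A) ∷ All.map InSpan-∷ (members-inSpan A)

_≟ᵥ_ : ∀ {n} (x y : V n) → Dec (x ≡ y)
_≟ᵥ_ = ≡-dec _≟ᵇ_

InSpan? : ∀ {n k} (B : Vec (V n) k) → Decidable (InSpan B)
InSpan? B x = anySubset? (λ c → lincomb c B ≟ᵥ x)

independent-∷ : ∀ {n k} {x : V n} {B : Vec (V n) k} → Independent B → ¬ InSpan B x →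
                Independent (x ∷ B)
independent-∷ ind x∉B (true  ∷ c) e = ⊥-elim (x∉B (c , sym (⊕≡0⇒≡ e)))
independent-∷ ind x∉B (false ∷ c) e = cong (false ∷_) (ind c (trans (sym (⊕-identityˡ _)) e))

independent-tail : ∀ {n k} {x : V n} {B : Vec (V n) k} → Independent (x ∷ B) → Independent B
independent-tail ind c e = cong tail (ind (false ∷ c) (trans (⊕-identityˡ _) e))

independent⇒head∉span : ∀ {n k} {x : V n} {B : Vec (V n) k} → Independent (x ∷ B) →
                        ¬ InSpan B x
independent⇒head∉span {x = x} ind (c , e) with ind (true ∷ c) (trans (cong (x ⊕_) e) (⊕-self x))
... | ()

record IndependentFamily {n} (P : V n → Set) (m : ℕ) : Set where
  constructor family
  field
    vectors     : Vec (V n) m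
    independent : Independent vectors
    members     : All P vectors

open IndependentFamily

shear : ∀ {n} → (V n → Bool) → V n → V n → V n
shear φ u v = v ⊕ (φ v · u)

module _ {n} {φ : V n → Bool} (linear : Linear φ) {u : V n} where

  shear-additive : Additive (shear φ u)
  shear-additive x y = begin
    (x ⊕ y) ⊕ (φ (x ⊕ y) · u)          ≡⟨ cong (λ b → (x ⊕ y) ⊕ (b · u)) (linear x y) ⟩
    (x ⊕ y) ⊕ ((φ x xor φ y) · u)      ≡⟨ cong ((x ⊕ y) ⊕_) (xor-· (φ x) (φ y) u) ⟩
    (x ⊕ y) ⊕ ((φ x · u) ⊕ (φ y · u))  ≡⟨ ⊕-interchange x y _ _ ⟩
    shear φ u x ⊕ shear φ u y          ∎

  shear-Ker : φ u ≡ true → ∀ v → Ker φ (shear φ u v)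
  shear-Ker φu v = begin
    φ (v ⊕ (φ v · u))     ≡⟨ linear v _ ⟩
    φ v xor φ (φ v · u)   ≡⟨ cong (φ v xor_) (linear-· {φ = φ} linear (φ v) u) ⟩
    φ v xor (φ v ∧ φ u)   ≡⟨ cong (λ b → φ v xor (φ v ∧ b)) φu ⟩
    φ v xor (φ v ∧ true)  ≡⟨ cong (φ v xor_) (∧-identityʳ (φ v)) ⟩
    φ v xor φ v           ≡⟨ xor-same (φ v) ⟩
    false                 ∎

  shear-independent : ∀ {k} {us : Vec (V n) k} → Independent (u ∷ us) →
                      Independent (map (shear φ u) us)
  shear-independent {us = us} ind c e =
    cong tail (ind (φ y ∷ c) (trans (⊕-comm (φ y · u) y) sheared-y≡0))
    where
      y = lincomb c us
      sheared-y≡0 : shear φ u y ≡ 0v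
      sheared-y≡0 = trans (sym (lincomb-map shear-additive c us)) e

-- If some vector u lies outside Ker φ, shear the others along u into Ker φ.
kernel-section : ∀ {n m} {φ : V n → Bool} → Linear φ → (U : Vec (V n) (suc m)) →
                 Independent U → IndependentFamily (InSpan U ∩ Ker φ) m
kernel-section {m = zero} linear (u ∷ []) ind = family [] (λ { [] _ → refl }) []
kernel-section {m = suc m} {φ} linear (u ∷ us) ind with φ u in φu | members-inSpan (u ∷ us)
... | true  | u∈U ∷ us⊆U =
  family (map (shear φ u) us) (shear-independent {φ = φ} linear ind)
         (map⁺ (All.map (λ {v} v∈U → sheared-inSpan v∈U , shear-Ker {φ = φ} linear φu v) us⊆U))
  where
    sheared-inSpan : ∀ {v} → InSpan (u ∷ us) v → InSpan (u ∷ us) (shear φ u v)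
    sheared-inSpan {v} v∈U =
      ⊕-closed (InSpan-subspace (u ∷ us)) v∈U (·-closed (InSpan-subspace (u ∷ us)) (φ v) u∈U)
... | false | u∈U ∷ _ =
  family (u ∷ vectors S) (independent-∷ (independent S) u∉S)
         ((u∈U , φu) ∷ All.map (λ (v∈us , φv) → InSpan-∷ v∈us , φv) (members S))
  where
    S = kernel-section linear us (independent-tail ind)
    u∉S : ¬ InSpan (vectors S) u
    u∉S = independent⇒head∉span ind ∘ span⊆ (InSpan-subspace us) (All.map proj₁ (members S))

tail-independent : ∀ {n m} {R : Vec (V (suc n)) m} → Independent R → All (Ker head) R →
                   Independent (map tail R)
tail-independent {R = R} ind R⊆Ker c e =
  ind c (head-tail-0 (lincomb-closed (Ker-subspace head-linear) R⊆Ker c)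
                     (trans (sym (lincomb-map tail-additive c R)) e))

independent⇒length≤ : ∀ {n m} {A : Vec (V n) m} → Independent A → m ≤ n
independent⇒length≤ {m = zero} _ = z≤n
independent⇒length≤ {zero} {suc m} ind with ind (true ∷ 0v) (V₀-trivial _)
... | ()
independent⇒length≤ {suc n} {suc m} {A} ind =
  s≤s (independent⇒length≤ (tail-independent (independent S) (All.map proj₂ (members S))))
  where
    S = kernel-section head-linear A ind

module _ {n k} {B : Vec (V n) k} where

  coefficients : ∀ {m} {A : Vec (V n) m} → All (InSpan B) A → Vec (Vec Bool k) m
  coefficients []             = []
  coefficients ((c , _) ∷ cs) = c ∷ coefficients cs

  coefficients-spec : ∀ {m} {A : Vec (V n) m} (A⊆B : All (InSpan B) A) →
                      map (λ c → lincomb c B) (coefficients A⊆B) ≡ A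
  coefficients-spec []                = refl
  coefficients-spec ((c , refl) ∷ cs) = cong (_ ∷_) (coefficients-spec cs)

  coefficients-independent : ∀ {m} {A : Vec (V n) m} → Independent A →
                             (A⊆B : All (InSpan B) A) → Independent (coefficients A⊆B)
  coefficients-independent {A = A} ind A⊆B d e = ind d (begin
    lincomb d A                            ≡⟨ cong (lincomb d) (sym (coefficients-spec A⊆B)) ⟩
    lincomb d (map (λ c → lincomb c B) C)  ≡⟨ lincomb-map (lincomb-additive B) d C ⟩
    lincomb (lincomb d C) B                ≡⟨ cong (λ c → lincomb c B) e ⟩
    lincomb 0v B                           ≡⟨ lincomb-zeroˡ B ⟩
    0v                                     ∎)
    where
      C = coefficients A⊆B

  span-length≤ : ∀ {m} {A : Vec (V n) m} → Independent A → All (InSpan B) A → m ≤ k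
  span-length≤ ind A⊆B = independent⇒length≤ (coefficients-independent ind A⊆B)

module Basis {n} {B : Vec (V n) n} (ind : Independent B) where

  spans : ∀ x → InSpan B x
  spans x with InSpan? B x
  ... | yes x∈B = x∈B
  ... | no  x∉B = ⊥-elim (1+n≰n (independent⇒length≤ (independent-∷ ind x∉B)))

  coordinates : V n → Vec Bool n
  coordinates x = proj₁ (spans x)

  coordinates-spec : ∀ x → lincomb (coordinates x) B ≡ x
  coordinates-spec x = proj₂ (spans x)

  coordinates-unique : ∀ {c x} → lincomb c B ≡ x → coordinates x ≡ c
  coordinates-unique {c} {x} e = ⊕≡0⇒≡ (ind (coordinates x ⊕ c) (begin
    lincomb (coordinates x ⊕ c) B            ≡⟨ lincomb-additive B (coordinates x) c ⟩
    lincomb (coordinates x) B ⊕ lincomb c B  ≡⟨ cong₂ _⊕_ (coordinates-spec x) e ⟩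
    x ⊕ x                                    ≡⟨ ⊕-self x ⟩
    0v                                       ∎))

  coordinates-additive : Additive coordinates
  coordinates-additive x y = coordinates-unique (begin
    lincomb (coordinates x ⊕ coordinates y) B
      ≡⟨ lincomb-additive B (coordinates x) (coordinates y) ⟩
    lincomb (coordinates x) B ⊕ lincomb (coordinates y) B
      ≡⟨ cong₂ _⊕_ (coordinates-spec x) (coordinates-spec y) ⟩
    x ⊕ y
      ∎)

⊆F⇒span⊆ : ∀ {n j k} {W : Vec (V n) j} {B : Vec (V n) k} → W ⊆F B → InSpan W ⊆ InSpan B
⊆F⇒span⊆ {B = B} W⊆B {x} x∈W with x ≟ᵥ 0v
... | yes refl = 0∈ (InSpan-subspace B)
... | no  x≢0  = proj₂ (W⊆B x (x≢0 , x∈W))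

avoidingFlat-length≤ : ∀ {n k j} {M : Matroid n} {B : Vec (V n) k} → AvoidingFlat M B j → j ≤ k
avoidingFlat-length≤ (W , indW , W⊆B , _) =
  span-length≤ indW (All.map (⊆F⇒span⊆ W⊆B) (members-inSpan W))

Avoids : ∀ {n k} → Matroid n → Vec (V n) k → Set
Avoids M W = ∀ x → x ∈F W → ¬ (x ∈E M)

AvoidingFlatInG : ∀ {n} → Matroid n → ℕ → Set
AvoidingFlatInG {n} M j = Σ (Vec (V n) j) λ W → Independent W × Avoids M W

module Semidoubling {p : ℕ} (M : Matroid (suc (suc p)))
  (G₀ : Vec (V (suc (suc p))) (suc p)) (H₀ : Vec (V (suc (suc p))) p)
  (indG₀ : Independent G₀) (indH₀ : Independent H₀) (H₀⊆G₀ : H₀ ⊆F G₀)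
  (w : V (suc (suc p))) (w≢0 : w ≢ 0v) (w∉G₀ : ¬ (w ∈F G₀)) (w∉E : ¬ (w ∈E M))
  (E-char : ∀ y → y ∈E M ⇔′
       ((y ∈E M × y ∈F G₀) ⊎
        (∃[ x ] (((x ∈E M × x ∈F G₀) △ (x ∈F G₀ × ¬ (x ∈F H₀))) × y ≡ w ⊕ x))))
  where

  spanH₀⊆spanG₀ : InSpan H₀ ⊆ InSpan G₀
  spanH₀⊆spanG₀ = ⊆F⇒span⊆ H₀⊆G₀

  w∉spanG₀ : ¬ InSpan G₀ w
  w∉spanG₀ w∈G₀ = w∉G₀ (w≢0 , w∈G₀)

  w⊕x≢0 : ∀ {x} → InSpan G₀ x → w ⊕ x ≢ 0v
  w⊕x≢0 x∈G₀ e = w∉spanG₀ (subst (InSpan G₀) (sym (⊕≡0⇒≡ e)) x∈G₀)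

  E-shift-H₀ : ∀ {x} → x ∈F H₀ → x ∈E M → (w ⊕ x) ∈E M
  E-shift-H₀ {x} x∈H₀ x∈E =
    proj₂ (E-char (w ⊕ x))
      (inj₂ (x , inj₁ ((x∈E , H₀⊆G₀ x x∈H₀) , λ (_ , x∉H₀) → x∉H₀ x∈H₀) , refl))

  E-shift-G₀∖H₀ : ∀ {x} → x ∈F G₀ → ¬ (x ∈F H₀) → ¬ (x ∈E M) → (w ⊕ x) ∈E M
  E-shift-G₀∖H₀ {x} x∈G₀ x∉H₀ x∉E =
    proj₂ (E-char (w ⊕ x)) (inj₂ (x , inj₂ ((x∈G₀ , x∉H₀) , λ (x∈E , _) → x∉E x∈E) , refl))

  E-unshift-H₀ : ∀ {x} → x ∈F H₀ → (w ⊕ x) ∈E M → x ∈E M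
  E-unshift-H₀ {x} x∈H₀ w⊕x∈E with proj₁ (E-char (w ⊕ x)) w⊕x∈E
  ... | inj₁ (_ , _ , w⊕x∈G₀) =
    ⊥-elim (w∉spanG₀ (subst (InSpan G₀) (⊕-cancelʳ w x)
      (⊕-closed (InSpan-subspace G₀) w⊕x∈G₀ (spanH₀⊆spanG₀ (proj₂ x∈H₀)))))
  ... | inj₂ (x′ , x′∈△ , e) with ⊕-injectiveˡ w e
  ...   | refl with x′∈△
  ...     | inj₁ ((x∈E , _) , _)  = x∈E
  ...     | inj₂ ((_ , x∉H₀) , _) = ⊥-elim (x∉H₀ x∈H₀)

  G₀⊈H₀ : Σ (Vec Bool (suc p)) λ c → ¬ InSpan H₀ (lincomb c G₀)
  G₀⊈H₀ with anySubset? (λ c → ¬? (InSpan? H₀ (lincomb c G₀)))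
  ... | yes found = found
  ... | no  none  =
    ⊥-elim (1+n≰n (span-length≤ indG₀ (All.map spanG₀⊆spanH₀ (members-inSpan G₀))))
    where
      spanG₀⊆spanH₀ : InSpan G₀ ⊆ InSpan H₀
      spanG₀⊆spanH₀ (c , refl) = decidable-stable (InSpan? H₀ _) (λ c∉H₀ → none (c , c∉H₀))

  g : V (suc (suc p))
  g = lincomb (proj₁ G₀⊈H₀) G₀

  gH₀⊆G₀ : All (InSpan G₀) (g ∷ H₀)
  gH₀⊆G₀ = (proj₁ G₀⊈H₀ , refl) ∷ All.map spanH₀⊆spanG₀ (members-inSpan H₀)

  basis : Vec (V (suc (suc p))) (suc (suc p))
  basis = w ∷ g ∷ H₀

  basis-independent : Independent basis
  basis-independent = independent-∷ (independent-∷ indH₀ (proj₂ G₀⊈H₀))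
                                     (w∉spanG₀ ∘ span⊆ (InSpan-subspace G₀) gH₀⊆G₀)

  open Basis basis-independent

  w-coordinate g-coordinate : V (suc (suc p)) → Bool
  w-coordinate = head ∘ coordinates
  g-coordinate = head ∘ tail ∘ coordinates

  w-coordinate-linear : Linear w-coordinate
  w-coordinate-linear = linear-∘ {φ = head} head-linear coordinates-additive

  g-coordinate-linear : Linear g-coordinate
  g-coordinate-linear =
    linear-∘ {φ = head ∘ tail} (linear-∘ {φ = head} head-linear tail-additive) coordinates-additive

  w-coordinate-w : w-coordinate w ≡ true
  w-coordinate-w = cong head (coordinates-unique {c = true ∷ 0v} (lincomb-head w (g ∷ H₀)))

  Ker-w-coordinate⊆spanG₀ : Ker w-coordinate ⊆ InSpan G₀
  Ker-w-coordinate⊆spanG₀ {x} wx≡0 =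
    subst (InSpan G₀) (coordinates-spec x) (in-G₀ (coordinates x) wx≡0)
    where
      in-G₀ : ∀ c → head c ≡ false → InSpan G₀ (lincomb c basis)
      in-G₀ (false ∷ c) refl = subst (InSpan G₀) (sym (⊕-identityˡ _))
                                     (span⊆ (InSpan-subspace G₀) gH₀⊆G₀ (c , refl))

  Ker-coordinates⊆spanH₀ : Ker w-coordinate ∩ Ker g-coordinate ⊆ InSpan H₀
  Ker-coordinates⊆spanH₀ {x} (wx≡0 , gx≡0) =
    subst (InSpan H₀) (coordinates-spec x) (in-H₀ (coordinates x) wx≡0 gx≡0)
    where
      in-H₀ : ∀ c → head c ≡ false → head (tail c) ≡ false → InSpan H₀ (lincomb c basis)
      in-H₀ (false ∷ false ∷ c) refl refl = c , sym (trans (⊕-identityˡ _) (⊕-identityˡ _))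

  extend-by-w : ∀ {j} → AvoidingFlat M H₀ j → AvoidingFlatInG M (suc j)
  extend-by-w (F , indF , F⊆H₀ , avoidF) = w ∷ F , independent-∷ indF w∉F , avoid
    where
      w∉F : ¬ InSpan F w
      w∉F = w∉spanG₀ ∘ spanH₀⊆spanG₀ ∘ ⊆F⇒span⊆ F⊆H₀
      avoid : Avoids M (w ∷ F)
      avoid x (x≢0 , false ∷ c , e) = avoidF x (x≢0 , c , trans (sym (⊕-identityˡ _)) e)
      avoid x (x≢0 , true  ∷ c , e) x∈E with lincomb c F ≟ᵥ 0v
      ... | yes f≡0 =
        w∉E (subst (_∈E M) (trans (sym e) (trans (cong (w ⊕_) f≡0) (⊕-identityʳ w))) x∈E)
      ... | no  f≢0 =
        avoidF _ (f≢0 , c , refl)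
          (E-unshift-H₀ (f≢0 , ⊆F⇒span⊆ F⊆H₀ (c , refl)) (subst (_∈E M) (sym e) x∈E))

  module _ {k} {U : Vec (V (suc (suc p))) k} (avoidU : Avoids M U) where

    avoids-H₀∩span : ∀ x → x ≢ 0v → InSpan H₀ x → InSpan (w ∷ U) x → ¬ (x ∈E M)
    avoids-H₀∩span x x≢0 x∈H₀ (false ∷ c , e) =
      avoidU x (x≢0 , c , trans (sym (⊕-identityˡ _)) e)
    avoids-H₀∩span x x≢0 x∈H₀ (true  ∷ c , e) x∈E =
      avoidU y (y≢0 , c , refl) (subst (_∈E M) w⊕x≡y (E-shift-H₀ (x≢0 , x∈H₀) x∈E))
      where
        y = lincomb c U
        w⊕x≡y : w ⊕ x ≡ y
        w⊕x≡y = trans (cong (w ⊕_) (sym e)) (⊕-cancelˡ w y)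
        y≢0 : y ≢ 0v
        y≢0 = subst (_≢ 0v) w⊕x≡y (w⊕x≢0 (spanH₀⊆spanG₀ x∈H₀))

    family⇒avoidingFlat : ∀ {j} → IndependentFamily (InSpan H₀ ∩ InSpan (w ∷ U)) j →
                          AvoidingFlat M H₀ j
    family⇒avoidingFlat (family W indW W⊆) =
      W , indW , (λ x (x≢0 , x∈W) → x≢0 , proj₁ (spanW⊆ x∈W))
        , (λ x (x≢0 , x∈W) → avoids-H₀∩span x x≢0 (proj₁ (spanW⊆ x∈W)) (proj₂ (spanW⊆ x∈W)))
      where
        spanW⊆ : InSpan W ⊆ InSpan H₀ ∩ InSpan (w ∷ U)
        spanW⊆ = span⊆ (∩-subspace (InSpan-subspace H₀) (InSpan-subspace (w ∷ U))) W⊆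

  section-through-w : ∀ {m} {U : Vec (V (suc (suc p))) (suc m)} → Independent U →
                      Avoids M U → InSpan U w → IndependentFamily (InSpan H₀ ∩ InSpan (w ∷ U)) m
  section-through-w {U = U} indU avoidU w∈U =
    family (vectors S) (independent S)
           (All.map (λ (x∈U , wx≡0) → U∩G₀⊆H₀ x∈U wx≡0 , InSpan-∷ x∈U) (members S))
    where
      S = kernel-section w-coordinate-linear U indU
      U∩G₀⊆H₀ : ∀ {x} → InSpan U x → Ker w-coordinate x → InSpan H₀ x
      U∩G₀⊆H₀ {x} x∈U wx≡0 with x ≟ᵥ 0v | InSpan? H₀ x
      ... | yes refl | _         = 0∈ (InSpan-subspace H₀)
      ... | no  _    | yes x∈H₀ = x∈H₀
      ... | no  x≢0  | no  x∉H₀ =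
        ⊥-elim (avoidU (w ⊕ x) (w⊕x≢0 x∈G₀ , ⊕-closed (InSpan-subspace U) w∈U x∈U)
                 (E-shift-G₀∖H₀ (x≢0 , x∈G₀) (x∉H₀ ∘ proj₂) (avoidU x (x≢0 , x∈U))))
        where
          x∈G₀ = Ker-w-coordinate⊆spanG₀ wx≡0

  section-avoiding-w : ∀ {m} {U : Vec (V (suc (suc p))) (suc m)} → Independent U →
                       ¬ InSpan U w → IndependentFamily (InSpan H₀ ∩ InSpan (w ∷ U)) m
  section-avoiding-w {U = U} indU w∉U =
    family (vectors S₂) (independent S₂) (All.map in-H₀∩span (members S₂))
    where
      S₁ = kernel-section w-coordinate-linear (w ∷ U) (independent-∷ indU w∉U)
      S₂ = kernel-section g-coordinate-linear (vectors S₁) (independent S₁)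
      spanS₁⊆ : InSpan (vectors S₁) ⊆ InSpan (w ∷ U) ∩ Ker w-coordinate
      spanS₁⊆ = span⊆ (∩-subspace (InSpan-subspace (w ∷ U)) (Ker-subspace w-coordinate-linear))
                      (members S₁)
      in-H₀∩span : InSpan (vectors S₁) ∩ Ker g-coordinate ⊆ InSpan H₀ ∩ InSpan (w ∷ U)
      in-H₀∩span (x∈S₁ , gx≡0) =
        Ker-coordinates⊆spanH₀ (proj₂ (spanS₁⊆ x∈S₁) , gx≡0) , proj₁ (spanS₁⊆ x∈S₁)

  restrict-to-H₀ : ∀ {m} → AvoidingFlatInG M (suc m) → AvoidingFlat M H₀ m
  restrict-to-H₀ (U , indU , avoidU) with InSpan? U w
  ... | yes w∈U = family⇒avoidingFlat avoidU (section-through-w indU avoidU w∈U)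
  ... | no  w∉U = family⇒avoidingFlat avoidU (section-avoiding-w indU w∉U)

lemma4p4 : ∀ {p : ℕ} (M : Matroid (suc (suc p)))
    (G₀ : Vec (V (suc (suc p))) (suc p)) (H₀ : Vec (V (suc (suc p))) p) →
    Independent G₀ → Independent H₀ → H₀ ⊆F G₀ →
    IsSemidoubling M G₀ H₀ →
    ∀ (k : ℕ) → IsCriticalNumberOn M H₀ k → IsCriticalNumber M (suc k)
lemma4p4 {p} M G₀ H₀ indG₀ indH₀ H₀⊆G₀ (w , w≢0 , w∉G₀ , w∉E , E-char) k
         (k≤p , avoidingH₀ , minimal) =
  s≤s (m≤n⇒m≤1+n k≤p) , upper , lower
  where
    open Semidoubling M G₀ H₀ indG₀ indH₀ H₀⊆G₀ w w≢0 w∉G₀ w∉E E-char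

    upper : AvoidingFlatInG M (suc p ∸ k)
    upper = subst (AvoidingFlatInG M) (sym (+-∸-assoc 1 k≤p)) (extend-by-w avoidingH₀)

    lower : ∀ k′ → k′ < suc k → ¬ AvoidingFlatInG M (suc (suc p) ∸ k′)
    lower zero    _         flat = 1+n≰n (avoidingFlat-length≤ {M = M} (restrict-to-H₀ flat))
    lower (suc j) (s≤s j<k) flat =
      minimal j j<k (restrict-to-H₀ (subst (AvoidingFlatInG M) (+-∸-assoc 1 j≤p) flat))
      where
        j≤p = ≤-trans (<⇒≤ j<k) k≤p
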